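{- Let $p$ be a prime, let $M\in\mathrm{Mat}_{p+1,p+1}(\mathbb{Z})$ be the matrix with all diagonal entries $0$ and all off-diagonal entries $1$, and for $t\ge1$ let $M^{\otimes t}$ be its $t$-fold Kronecker product, viewed as a tensor in $\mathbb{Z}^{(p+1)^t}\otimes\mathbb{Z}^{(p+1)^t}$. Then $$\frac{\operatorname{trk}_p(M^{\otimes t})}{\operatorname{trk}_0(M^{\otimes t})}=\left(\frac{p}{p+1}\right)^t.$$
   Context: For a tensor $T\in\mathbb{Z}^{n_1}\otimes\cdots\otimes\mathbb{Z}^{n_m}$ and a field $K$, $T$ is viewed as $T\otimes_{\mathbb{Z}}1\in K^{n_1}\otimes\cdots\otimes K^{n_m}$, and $\operatorname{trk}_q(T)$ denotes its tensor rank (least number of simple tensors summing to it) over an algebraically closed field of characteristic $q$ ($q$ equal to $0$ or a prime). For matrices, tensor rank equals matrix rank. -}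

module Defs where

open import Level using (Level; _⊔_) renaming (suc to lsuc)
open import Algebra.Bundles using (CommutativeRing)
open import Data.Nat as ℕ using (ℕ; zero; suc; _^_)
open import Data.Nat.Divisibility using (_∣_)
open import Data.Integer as ℤ using (ℤ; +_; -[1+_])
open import Data.Fin using (Fin; zero; suc; remQuot)
open import Data.Product using (Σ; ∃; _×_; _,_; proj₁; proj₂)
open import Relation.Nullary using (¬_)
open import Function.Bundles using (_⇔_)

record Field (c ℓ : Level) : Set (lsuc (c ⊔ ℓ)) where
  field
    commRing : CommutativeRing c ℓ
  open CommutativeRing commRing public
  field
    0≉1     : ¬ (0# ≈ 1#)
    inverse : ∀ x → ¬ (x ≈ 0#) → ∃ λ y → x * y ≈ 1#

module _ {c ℓ} (K : Field c ℓ) where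
  open Field K using (Carrier; _≈_; _+_; _*_; -_; 0#; 1#)

  natK : ℕ → Carrier
  natK zero    = 0#
  natK (suc n) = 1# + natK n

  intK : ℤ → Carrier
  intK (+ n)      = natK n
  intK -[1+ n ]   = - natK (suc n)

  powK : Carrier → ℕ → Carrier
  powK x zero    = 1#
  powK x (suc n) = x * powK x n

  sumK : ∀ n → (Fin n → Carrier) → Carrier
  sumK zero    f = 0#
  sumK (suc n) f = f zero + sumK n (λ i → f (suc i))

  HasChar : ℕ → Set ℓ
  HasChar q = ∀ n → (natK n ≈ 0#) ⇔ (q ∣ n)

  AlgClosed : Set (c ⊔ ℓ)
  AlgClosed = ∀ n (a : Fin (suc n) → Carrier) →
    ∃ λ x → powK x (suc n) + sumK (suc n) (λ i → a i * powK x (Data.Fin.toℕ i)) ≈ 0#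

  -- An m×n matrix over K (= element of K^m ⊗ K^n) is a sum of r simple tensors u_k ⊗ v_k.
  SumOfSimple : ∀ {m n} → (Fin m → Fin n → Carrier) → ℕ → Set (c ⊔ ℓ)
  SumOfSimple {m} {n} A r =
    Σ (Fin r → Fin m → Carrier) λ u → Σ (Fin r → Fin n → Carrier) λ v →
      ∀ i j → A i j ≈ sumK r (λ k → u k i * v k j)

  IsTensorRank : ∀ {m n} → (Fin m → Fin n → ℤ) → ℕ → Set (c ⊔ ℓ)
  IsTensorRank T r =
    SumOfSimple (λ i j → intK (T i j)) r ×
    (∀ s → SumOfSimple (λ i j → intK (T i j)) s → r ℕ.≤ s)

kron : ∀ {m n m′ n′} → (Fin m → Fin n → ℤ) → (Fin m′ → Fin n′ → ℤ) →
       Fin (m ℕ.* m′) → Fin (n ℕ.* n′) → ℤ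
kron {m} {n} {m′} {n′} A B i j =
  A (proj₁ (remQuot {m} m′ i)) (proj₁ (remQuot {n} n′ j)) ℤ.*
  B (proj₂ (remQuot {m} m′ i)) (proj₂ (remQuot {n} n′ j))

kronPow : ∀ {n} → (Fin n → Fin n → ℤ) → (t : ℕ) → Fin (n ^ t) → Fin (n ^ t) → ℤ
kronPow A zero    i j = + 1
kronPow A (suc t) = kron A (kronPow A t)

offDiagOnes : ∀ n → Fin n → Fin n → ℤ
offDiagOnes n i j with i Data.Fin.≟ j
... | Relation.Nullary.yes _ = + 0
... | Relation.Nullary.no  _ = + 1

-- Write J − I for offDiagOnes (p + 1). Over any field, J − I has rank p when p = 0 in the field
-- (its row sums p vanish, and deleting the first row and column leaves a block B with
-- B(−J − I) = I − pJ = I), and is invertible otherwise, with inverse p⁻¹J − I. Both bounds pass to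
-- Kronecker powers: A = UV with inner dimension r gives A^⊗t = U^⊗t V^⊗t with inner dimension r^t,
-- and PAQ = I_m gives P^⊗t A^⊗t Q^⊗t = I_{m^t}, which forces tensor rank at least m^t because, by
-- Gaussian elimination, I_k can only factor through K^s when k ≤ s. Hence trk_p = p^t and
-- trk_0 = (p + 1)^t.
module Submission where

open import Level using (Level; _⊔_)
open import Algebra.Bundles using (CommutativeRing)
open import Data.Nat as ℕ using (ℕ; zero; suc; _^_)
open import Data.Nat.Properties using (≤-antisym; ≰⇒>; m<n⇒m<1+n)
open import Data.Integer as ℤ using (ℤ; _◃_; sign; ∣_∣)
open import Data.Integer.Properties using (◃-inverse)
open import Data.Sign as Sign using (Sign)
open import Data.Fin using (Fin; zero; suc; punchIn; _↑ˡ_; _↑ʳ_; combine; remQuot; quotient; remainder)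
open import Data.Fin.Properties
  using (remQuot-combine; combine-remQuot; punchIn-injective; punchInᵢ≢i; ∀-cons)
  renaming (_≟_ to _≟ᶠ_)
open import Data.Product using (_,_; uncurry; Σ-syntax)
open import Function using (_∘_)
open import Function.Bundles using (_⇔_; mk⇔; Equivalence)
open import Relation.Binary.Bundles using (Setoid)
import Relation.Binary.Reasoning.Setoid as SetoidReasoning
open import Relation.Binary.PropositionalEquality as ≡ using (_≡_; _≢_)
open import Relation.Nullary using (¬_; yes; no; contradiction)
open import Relation.Nullary.Decidable using (decidable-stable)
open import Defs

quotient-remainder-injective : ∀ {m n} {i j : Fin (m ℕ.* n)} →
  quotient {m} n i ≡ quotient {m} n j → remainder {m} n i ≡ remainder {m} n j → i ≡ j
quotient-remainder-injective {m} {n} {i} {j} q≡q′ r≡r′ = begin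
  i                                              ≡⟨ combine-remQuot {m} n i ⟨
  combine (quotient {m} n i) (remainder {m} n i) ≡⟨ ≡.cong₂ combine q≡q′ r≡r′ ⟩
  combine (quotient {m} n j) (remainder {m} n j) ≡⟨ combine-remQuot {m} n j ⟩
  j                                              ∎
  where open ≡.≡-Reasoning

module Matrices {c ℓ} (R : CommutativeRing c ℓ) where

  open CommutativeRing R hiding (zero)
  open import Algebra.Properties.Semiring.Mult semiring using (_×_; ×-congʳ; ×-assoc-*)
  open import Algebra.Properties.Ring ring
    using (-1*x≈-x; -‿distribˡ-*; [y-z]x≈yx-zx; -‿+-comm; xyx⁻¹≈y; -‿involutive; +-inverseʳ-unique)
  open import Algebra.Properties.Semiring.Sum semiring public
    using ( sum; sum-syntax; sum-cong-≋; sum-replicate; sum-replicate-zero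
          ; ∑-distrib-+; ∑-comm; *-distribˡ-sum; *-distribʳ-sum)

  private variable
    k l m n m′ n′ : ℕ

  Matrix : ℕ → ℕ → Set c
  Matrix m n = Fin m → Fin n → Carrier

  infix 4 _≋_
  _≋_ : Matrix m n → Matrix m n → Set ℓ
  A ≋ B = ∀ i j → A i j ≈ B i j

  ≋-refl : ∀ {A : Matrix m n} → A ≋ A
  ≋-refl _ _ = refl

  ≋-sym : ∀ {A B : Matrix m n} → A ≋ B → B ≋ A
  ≋-sym A≋B i j = sym (A≋B i j)

  ≋-trans : ∀ {A B C : Matrix m n} → A ≋ B → B ≋ C → A ≋ C
  ≋-trans A≋B B≋C i j = trans (A≋B i j) (B≋C i j)

  ≋-setoid : ℕ → ℕ → Setoid c ℓ
  ≋-setoid m n = record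
    { Carrier       = Matrix m n
    ; _≈_           = _≋_
    ; isEquivalence = record { refl = ≋-refl ; sym = ≋-sym ; trans = ≋-trans }
    }

  module ≋-Reasoning {m n : ℕ} = SetoidReasoning (≋-setoid m n)

  sum-↑ : ∀ (f : Fin (m ℕ.+ n) → Carrier) →
          sum f ≈ sum (λ i → f (i ↑ˡ n)) + sum (λ j → f (m ↑ʳ j))
  sum-↑ {zero} f = sym (+-identityˡ _)
  sum-↑ {suc m} {n} f = trans (+-congˡ (sum-↑ {m} {n} (λ i → f (suc i)))) (sym (+-assoc _ _ _))

  sum-combine : ∀ (f : Fin (m ℕ.* n) → Carrier) →
                sum f ≈ ∑[ a < m ] ∑[ b < n ] f (combine a b)
  sum-combine {zero} f = refl
  sum-combine {suc m} {n} f =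
    trans (sum-↑ {n} f) (+-congˡ (sum-combine {m} (λ k → f (n ↑ʳ k))))

  δ : Matrix n n
  δ zero    zero    = 1#
  δ zero    (suc _) = 0#
  δ (suc _) zero    = 0#
  δ (suc i) (suc j) = δ i j

  δ-refl : ∀ (i : Fin n) → δ i i ≡ 1#
  δ-refl zero    = ≡.refl
  δ-refl (suc i) = δ-refl i

  δ-≢ : ∀ {i j : Fin n} → i ≢ j → δ i j ≡ 0#
  δ-≢ {i = zero}  {zero}  i≢j = contradiction ≡.refl i≢j
  δ-≢ {i = zero}  {suc j} i≢j = ≡.refl
  δ-≢ {i = suc i} {zero}  i≢j = ≡.refl
  δ-≢ {i = suc i} {suc j} i≢j = δ-≢ (i≢j ∘ ≡.cong suc)

  δ-punchIn : ∀ (i : Fin (suc n)) (a b : Fin n) → δ (punchIn i a) (punchIn i b) ≡ δ a b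
  δ-punchIn i a b with a ≟ᶠ b
  ... | yes ≡.refl = ≡.trans (δ-refl (punchIn i a)) (≡.sym (δ-refl a))
  ... | no a≢b     = ≡.trans (δ-≢ (a≢b ∘ punchIn-injective i a b)) (≡.sym (δ-≢ a≢b))

  sum-δˡ : ∀ (i : Fin n) (f : Fin n → Carrier) → ∑[ j < n ] (δ i j * f j) ≈ f i
  sum-δˡ {suc n} zero f =
    trans (+-cong (*-identityˡ _) (trans (sum-cong-≋ (λ j → zeroˡ (f (suc j)))) (sum-replicate-zero n)))
          (+-identityʳ _)
  sum-δˡ (suc i) f = trans (+-cong (zeroˡ _) (sum-δˡ i (f ∘ suc))) (+-identityˡ _)

  sum-δʳ : ∀ (j : Fin n) (f : Fin n → Carrier) → ∑[ i < n ] (f i * δ i j) ≈ f j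
  sum-δʳ {suc n} zero f =
    trans (+-cong (*-identityʳ _) (trans (sum-cong-≋ (λ i → zeroʳ (f (suc i)))) (sum-replicate-zero n)))
          (+-identityʳ _)
  sum-δʳ (suc j) f = trans (+-cong (zeroʳ _) (sum-δʳ j (f ∘ suc))) (+-identityˡ _)

  sum-δ+δˡ : ∀ (x y : Fin n) c (f : Fin n → Carrier) → ∑[ j < n ] ((δ x j + c * δ y j) * f j) ≈ f x + c * f y
  sum-δ+δˡ {n} x y c f = begin
    ∑[ j < n ] ((δ x j + c * δ y j) * f j)
      ≈⟨ sum-cong-≋ (λ j → trans (distribʳ (f j) (δ x j) (c * δ y j)) (+-congˡ (*-assoc c (δ y j) (f j)))) ⟩
    ∑[ j < n ] (δ x j * f j + c * (δ y j * f j))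
      ≈⟨ ∑-distrib-+ (λ j → δ x j * f j) (λ j → c * (δ y j * f j)) ⟩
    ∑[ j < n ] (δ x j * f j) + ∑[ j < n ] (c * (δ y j * f j))
      ≈⟨ +-cong (sum-δˡ x f) (trans (sym (*-distribˡ-sum c (λ j → δ y j * f j))) (*-congˡ (sum-δˡ y f))) ⟩
    f x + c * f y ∎
    where open SetoidReasoning setoid

  infixl 7 _·_
  _·_ : Matrix m n → Matrix n l → Matrix m l
  (A · B) i j = ∑[ k < _ ] (A i k * B k j)

  ·-identityˡ : ∀ (A : Matrix m n) → δ · A ≋ A
  ·-identityˡ A i j = sum-δˡ i (λ k → A k j)

  ·-identityʳ : ∀ (A : Matrix m n) → A · δ ≋ A
  ·-identityʳ A i j = sum-δʳ j (A i)

  ·-cong : ∀ {A A′ : Matrix m n} {B B′ : Matrix n l} → A ≋ A′ → B ≋ B′ → A · B ≋ A′ · B′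
  ·-cong A≋A′ B≋B′ i j = sum-cong-≋ (λ k → *-cong (A≋A′ i k) (B≋B′ k j))

  ·-assoc : ∀ (A : Matrix m n) (B : Matrix n l) (C : Matrix l k) → (A · B) · C ≋ A · (B · C)
  ·-assoc {n = n} {l = l} A B C i j = begin
    ∑[ y < l ] (∑[ x < n ] (A i x * B x y) * C y j)
      ≈⟨ sum-cong-≋ (λ y → *-distribʳ-sum (C y j) (λ x → A i x * B x y)) ⟩
    ∑[ y < l ] ∑[ x < n ] ((A i x * B x y) * C y j)
      ≈⟨ ∑-comm (λ y x → (A i x * B x y) * C y j) ⟩
    ∑[ x < n ] ∑[ y < l ] ((A i x * B x y) * C y j)
      ≈⟨ sum-cong-≋ (λ x → sum-cong-≋ (λ y → *-assoc (A i x) (B x y) (C y j))) ⟩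
    ∑[ x < n ] ∑[ y < l ] (A i x * (B x y * C y j))
      ≈⟨ sum-cong-≋ (λ x → *-distribˡ-sum (A i x) (λ y → B x y * C y j)) ⟨
    ∑[ x < n ] (A i x * ∑[ y < l ] (B x y * C y j)) ∎
    where open SetoidReasoning setoid

  ·-sandwich : ∀ {B : Matrix n n′} (P : Matrix m n) (U : Matrix n k) (V : Matrix k n′) (Q : Matrix n′ l) →
               B ≋ U · V → P · B · Q ≋ (P · U) · (V · Q)
  ·-sandwich {B = B} P U V Q B≋UV = begin
    P · B · Q         ≈⟨ ·-cong (·-cong {A = P} ≋-refl B≋UV) ≋-refl ⟩
    P · (U · V) · Q   ≈⟨ ·-cong (λ i j → sym (·-assoc P U V i j)) ≋-refl ⟩
    P · U · V · Q     ≈⟨ ·-assoc (P · U) V Q ⟩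
    (P · U) · (V · Q) ∎
    where open ≋-Reasoning

  infixl 7 _⊗_
  _⊗_ : ∀ {m n m′ n′} → Matrix m n → Matrix m′ n′ → Matrix (m ℕ.* m′) (n ℕ.* n′)
  (_⊗_ {m} {n} {m′} {n′} A B) i j =
    A (quotient {m} m′ i) (quotient {n} n′ j) * B (remainder {m} m′ i) (remainder {n} n′ j)

  infixr 8 _^⊗_
  _^⊗_ : Matrix m n → (t : ℕ) → Matrix (m ^ t) (n ^ t)
  (A ^⊗ zero) _ _ = 1#
  A ^⊗ suc t      = A ⊗ (A ^⊗ t)

  ⊗-cong : ∀ {A A′ : Matrix m n} {B B′ : Matrix m′ n′} → A ≋ A′ → B ≋ B′ → A ⊗ B ≋ A′ ⊗ B′
  ⊗-cong {m} {n} {m′} {n′} A≋A′ B≋B′ i j =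
    *-cong (A≋A′ (quotient {m} m′ i) (quotient {n} n′ j)) (B≋B′ (remainder {m} m′ i) (remainder {n} n′ j))

  ^⊗-cong : ∀ {A A′ : Matrix m n} → A ≋ A′ → ∀ t → A ^⊗ t ≋ A′ ^⊗ t
  ^⊗-cong A≋A′ zero    _ _ = refl
  ^⊗-cong A≋A′ (suc t)     = ⊗-cong A≋A′ (^⊗-cong A≋A′ t)

  ⊗-·-distrib : ∀ {m n l m′ n′ l′} (A : Matrix m n) (B : Matrix m′ n′) (C : Matrix n l) (D : Matrix n′ l′) →
                (A ⊗ B) · (C ⊗ D) ≋ (A · C) ⊗ (B · D)
  ⊗-·-distrib {m} {n} {l} {m′} {n′} {l′} A B C D i j = begin
    ∑[ k < n ℕ.* n′ ] uncurry term (remQuot {n} n′ k)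
      ≈⟨ sum-combine {n} (uncurry term ∘ remQuot {n} n′) ⟩
    ∑[ a < n ] ∑[ b < n′ ] uncurry term (remQuot {n} n′ (combine a b))
      ≈⟨ sum-cong-≋ (λ a → sum-cong-≋ (λ b → reflexive (≡.cong (uncurry term) (remQuot-combine a b)))) ⟩
    ∑[ a < n ] ∑[ b < n′ ] ((A i₁ a * B i₂ b) * (C a j₁ * D b j₂))
      ≈⟨ sum-cong-≋ (λ a → sum-cong-≋ (λ b → interchange (A i₁ a) (B i₂ b) (C a j₁) (D b j₂))) ⟩
    ∑[ a < n ] ∑[ b < n′ ] ((A i₁ a * C a j₁) * (B i₂ b * D b j₂))
      ≈⟨ sum-cong-≋ (λ a → *-distribˡ-sum (A i₁ a * C a j₁) (λ b → B i₂ b * D b j₂)) ⟨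
    ∑[ a < n ] ((A i₁ a * C a j₁) * ∑[ b < n′ ] (B i₂ b * D b j₂))
      ≈⟨ *-distribʳ-sum (∑[ b < n′ ] (B i₂ b * D b j₂)) (λ a → A i₁ a * C a j₁) ⟨
    ∑[ a < n ] (A i₁ a * C a j₁) * ∑[ b < n′ ] (B i₂ b * D b j₂) ∎
    where
    open SetoidReasoning setoid
    open import Algebra.Properties.CommutativeSemigroup *-commutativeSemigroup using (interchange)
    i₁ : Fin m
    i₁ = quotient {m} m′ i
    i₂ : Fin m′
    i₂ = remainder {m} m′ i
    j₁ : Fin l
    j₁ = quotient {l} l′ j
    j₂ : Fin l′
    j₂ = remainder {l} l′ j
    term : Fin n → Fin n′ → Carrier
    term a b = (A i₁ a * B i₂ b) * (C a j₁ * D b j₂)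

  ^⊗-distrib-· : ∀ (A : Matrix m n) (B : Matrix n l) t → (A ^⊗ t) · (B ^⊗ t) ≋ (A · B) ^⊗ t
  ^⊗-distrib-· A B zero    zero zero = trans (+-identityʳ (1# * 1#)) (*-identityˡ 1#)
  ^⊗-distrib-· A B (suc t)           = begin
    (A ⊗ A ^⊗ t) · (B ⊗ B ^⊗ t) ≈⟨ ⊗-·-distrib A (A ^⊗ t) B (B ^⊗ t) ⟩
    (A · B) ⊗ (A ^⊗ t · B ^⊗ t) ≈⟨ ⊗-cong {A = A · B} ≋-refl (^⊗-distrib-· A B t) ⟩
    (A · B) ⊗ (A · B) ^⊗ t     ∎
    where open ≋-Reasoning

  δ⊗δ : δ {m} ⊗ δ {n} ≋ δ
  δ⊗δ {m} {n} i j with i ≟ᶠ j | quotient {m} n i ≟ᶠ quotient {m} n j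
  ... | yes ≡.refl | _ = trans (*-cong (reflexive (δ-refl (quotient {m} n i))) (reflexive (δ-refl (remainder {m} n i))))
                              (trans (*-identityˡ 1#) (reflexive (≡.sym (δ-refl i))))
  ... | no i≢j | no q≢q′ =
    trans (*-congʳ (reflexive (δ-≢ q≢q′))) (trans (zeroˡ _) (reflexive (≡.sym (δ-≢ i≢j))))
  ... | no i≢j | yes q≡q′ =
    trans (*-congˡ (reflexive (δ-≢ (i≢j ∘ quotient-remainder-injective q≡q′))))
          (trans (zeroʳ _) (reflexive (≡.sym (δ-≢ i≢j))))

  δ-^⊗ : ∀ t → δ {n} ^⊗ t ≋ δ
  δ-^⊗ zero    zero zero = refl
  δ-^⊗ {n} (suc t)       = ≋-trans (⊗-cong {A = δ {n}} ≋-refl (δ-^⊗ t)) (δ⊗δ {n} {n ^ t})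

  FactorsThrough : Matrix m n → ℕ → Set (c ⊔ ℓ)
  FactorsThrough {m} {n} A r = Σ[ U ∈ Matrix m r ] Σ[ V ∈ Matrix r n ] A ≋ U · V

  factorsThrough-self : ∀ (A : Matrix m n) → FactorsThrough A m
  factorsThrough-self A = δ , A , ≋-sym (·-identityˡ A)

  factorsThrough-≋ : ∀ {A B : Matrix m n} {r} → A ≋ B → FactorsThrough B r → FactorsThrough A r
  factorsThrough-≋ A≋B (U , V , B≋UV) = U , V , ≋-trans A≋B B≋UV

  factorsThrough-^⊗ : ∀ {A : Matrix m n} {r} → FactorsThrough A r → ∀ t → FactorsThrough (A ^⊗ t) (r ^ t)
  factorsThrough-^⊗ (U , V , A≋UV) t =
    U ^⊗ t , V ^⊗ t , ≋-trans (^⊗-cong A≋UV t) (≋-sym (^⊗-distrib-· U V t))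

  IdentityRetract : ℕ → Matrix n n′ → Set (c ⊔ ℓ)
  IdentityRetract {n} {n′} m A = Σ[ P ∈ Matrix m n ] Σ[ Q ∈ Matrix n′ m ] P · A · Q ≋ δ

  identityRetract-≋ : ∀ {A B : Matrix n n′} {m} → A ≋ B → IdentityRetract m B → IdentityRetract m A
  identityRetract-≋ A≋B (P , Q , PBQ≋δ) = P , Q , ≋-trans (·-cong (·-cong {A = P} ≋-refl A≋B) ≋-refl) PBQ≋δ

  identityRetract-^⊗-factorsThrough : ∀ {A : Matrix n n′} {m r} → IdentityRetract m A →
    ∀ t → FactorsThrough (A ^⊗ t) r → FactorsThrough (δ {m ^ t}) r
  identityRetract-^⊗-factorsThrough {A = A} (P , Q , PAQ≋δ) t (U , V , Aᵗ≋UV) = P ^⊗ t · U , V · Q ^⊗ t , (begin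
    δ                                ≈⟨ δ-^⊗ t ⟨
    δ ^⊗ t                           ≈⟨ ^⊗-cong PAQ≋δ t ⟨
    (P · A · Q) ^⊗ t                 ≈⟨ ^⊗-distrib-· (P · A) Q t ⟨
    (P · A) ^⊗ t · Q ^⊗ t            ≈⟨ ·-cong (^⊗-distrib-· P A t) ≋-refl ⟨
    P ^⊗ t · A ^⊗ t · Q ^⊗ t         ≈⟨ ·-sandwich (P ^⊗ t) U V (Q ^⊗ t) Aᵗ≋UV ⟩
    (P ^⊗ t · U) · (V · Q ^⊗ t)      ∎)
    where open ≋-Reasoning

  factorsThrough-dropZeroColumn : ∀ {A : Matrix m n} {s} (U : Matrix m (suc s)) (V : Matrix (suc s) n) →
    A ≋ U · V → (∀ i → U i zero ≈ 0#) → FactorsThrough A s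
  factorsThrough-dropZeroColumn U V A≋UV Uᵢ₀≈0 =
    (λ i l → U i (suc l)) , (λ l j → V (suc l) j) ,
    λ i j → trans (A≋UV i j) (trans (+-congʳ (trans (*-congʳ (Uᵢ₀≈0 i)) (zeroˡ _))) (+-identityˡ _))

  offDiag : ∀ n → Matrix n n
  offDiag n i j = 1# - δ i j

  affine : Carrier → Carrier → Matrix n n
  affine x y i j = x + y * δ i j

  affine-≋-δ : ∀ {x y} → x ≈ 0# → y ≈ 1# → affine {n} x y ≋ δ
  affine-≋-δ x≈0 y≈1 i j = trans (+-cong x≈0 (trans (*-congʳ y≈1) (*-identityˡ _))) (+-identityˡ _)

  sum-neg : ∀ (f : Fin n → Carrier) → ∑[ k < n ] (- f k) ≈ - sum f
  sum-neg f = trans (sum-cong-≋ (λ k → sym (-1*x≈-x (f k))))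
                    (trans (sym (*-distribˡ-sum (- 1#) f)) (-1*x≈-x (sum f)))

  ∑-offDiag-· : ∀ (i : Fin n) (g : Fin n → Carrier) → ∑[ k < n ] (offDiag n i k * g k) ≈ sum g - g i
  ∑-offDiag-· {n} i g = begin
    ∑[ k < n ] ((1# - δ i k) * g k)
      ≈⟨ sum-cong-≋ (λ k → trans ([y-z]x≈yx-zx (g k) 1# (δ i k)) (+-congʳ (*-identityˡ (g k)))) ⟩
    ∑[ k < n ] (g k - δ i k * g k)
      ≈⟨ ∑-distrib-+ g (λ k → - (δ i k * g k)) ⟩
    sum g + ∑[ k < n ] (- (δ i k * g k))
      ≈⟨ +-congˡ (trans (sum-neg (λ k → δ i k * g k)) (-‿cong (sum-δˡ i g))) ⟩
    sum g - g i ∎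
    where open SetoidReasoning setoid

  ×≈×1* : ∀ n x → n × x ≈ (n × 1#) * x
  ×≈×1* n x = trans (×-congʳ n (sym (*-identityˡ x))) (sym (×-assoc-* n 1# x))

  offDiag-·-affine : ∀ n x y → offDiag n · affine x y ≋ affine ((n × x + y) - x) (- y)
  offDiag-·-affine n x y i j = begin
    ∑[ k < n ] (offDiag n i k * affine x y k j)  ≈⟨ ∑-offDiag-· i (λ k → affine x y k j) ⟩
    ∑[ k < n ] (x + y * δ k j) - (x + y * δ i j) ≈⟨ +-cong column-sum (sym (-‿+-comm x (y * δ i j))) ⟩
    (n × x + y) + (- x + - (y * δ i j))          ≈⟨ +-assoc (n × x + y) (- x) (- (y * δ i j)) ⟨
    (n × x + y) - x + - (y * δ i j)              ≈⟨ +-congˡ (-‿distribˡ-* y (δ i j)) ⟩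
    (n × x + y) - x + - y * δ i j                ∎
    where
    open SetoidReasoning setoid
    column-sum : ∑[ k < n ] (x + y * δ k j) ≈ n × x + y
    column-sum = trans (∑-distrib-+ (λ _ → x) (λ k → y * δ k j)) (+-cong (sum-replicate n) (sum-δʳ j (λ _ → y)))

  ∑-offDiag : ∀ n (i : Fin (suc n)) → ∑[ k < suc n ] offDiag (suc n) i k ≈ n × 1#
  ∑-offDiag n i = begin
    ∑[ k < suc n ] offDiag (suc n) i k          ≈⟨ sum-cong-≋ (λ k → *-identityʳ (offDiag (suc n) i k)) ⟨
    ∑[ k < suc n ] (offDiag (suc n) i k * 1#)   ≈⟨ ∑-offDiag-· i (λ _ → 1#) ⟩
    ∑[ k < suc n ] 1# - 1#                      ≈⟨ +-congʳ (sum-replicate (suc n)) ⟩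
    (1# + n × 1#) - 1#                          ≈⟨ xyx⁻¹≈y 1# (n × 1#) ⟩
    n × 1#                                      ∎
    where open SetoidReasoning setoid

  module _ {p} (p≈0 : p × 1# ≈ 0#) where

    p×x≈0 : ∀ x → p × x ≈ 0#
    p×x≈0 x = trans (×≈×1* p x) (trans (*-congʳ p≈0) (zeroˡ x))

    offDiag-factorsThrough-charDiv : FactorsThrough (offDiag (suc p)) p
    offDiag-factorsThrough-charDiv = U , V , O≋UV
      where
      -- Row sums of J − I are p = 0, so column 0 is minus the sum of the other columns.
      O : Matrix (suc p) (suc p)
      O = offDiag (suc p)
      U : Matrix (suc p) p
      U i a = O i (suc a)
      V : Matrix p (suc p)
      V a zero    = - 1#
      V a (suc j) = δ a j
      tail-sum : ∀ i → ∑[ a < p ] O i (suc a) ≈ - O i zero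
      tail-sum i = +-inverseʳ-unique (O i zero) _ (trans (∑-offDiag p i) p≈0)
      O≋UV : O ≋ U · V
      O≋UV i zero = sym (begin
        ∑[ a < p ] (O i (suc a) * - 1#) ≈⟨ *-distribʳ-sum (- 1#) (U i) ⟨
        ∑[ a < p ] O i (suc a) * - 1#   ≈⟨ *-comm _ (- 1#) ⟩
        - 1# * ∑[ a < p ] O i (suc a)   ≈⟨ -1*x≈-x _ ⟩
        - ∑[ a < p ] O i (suc a)        ≈⟨ -‿cong (tail-sum i) ⟩
        - - O i zero                    ≈⟨ -‿involutive (O i zero) ⟩
        O i zero                        ∎)
        where open SetoidReasoning setoid
      O≋UV i (suc j) = sym (sum-δʳ j (U i))

    offDiag-identityRetract-charDiv : IdentityRetract p (offDiag (suc p))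
    offDiag-identityRetract-charDiv = P , Q , POQ≋δ
      where
      -- P and Q cut out the lower right p × p block B = J − I, and B (−J − I) = I − pJ = I.
      O : Matrix (suc p) (suc p)
      O = offDiag (suc p)
      P : Matrix p (suc p)
      P a = δ (suc a)
      Q : Matrix (suc p) p
      Q zero    _ = 0#
      Q (suc j) b = affine (- 1#) (- 1#) j b
      POQ≋δ : P · O · Q ≋ δ
      POQ≋δ a b = begin
        ∑[ j < suc p ] ((P · O) a j * Q j b)
          ≈⟨ sum-cong-≋ (λ j → *-congʳ {Q j b} (·-identityˡ O (suc a) j)) ⟩
        O (suc a) zero * 0# + ∑[ j < p ] (offDiag p a j * affine (- 1#) (- 1#) j b)
          ≈⟨ trans (+-congʳ (zeroʳ _)) (+-identityˡ _) ⟩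
        (offDiag p · affine (- 1#) (- 1#)) a b
          ≈⟨ offDiag-·-affine p (- 1#) (- 1#) a b ⟩
        affine ((p × - 1# + - 1#) - - 1#) (- - 1#) a b
          ≈⟨ affine-≋-δ (trans (trans (+-congʳ (+-comm _ _)) (xyx⁻¹≈y _ _)) (p×x≈0 (- 1#)))
                        (-‿involutive 1#) a b ⟩
        δ a b ∎
        where open SetoidReasoning setoid

  -- (J − I)(yJ − I) = I for y = p⁻¹, because J² = (p + 1)J.
  offDiag-identityRetract-inverse : ∀ {p y} → y * (p × 1#) ≈ 1# → IdentityRetract (suc p) (offDiag (suc p))
  offDiag-identityRetract-inverse {p} {y} y·p≈1 = δ , affine y (- 1#) ,
    ≋-trans (·-cong {B = affine y (- 1#)} (·-identityˡ O) ≋-refl)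
            (≋-trans (offDiag-·-affine (suc p) y (- 1#)) (affine-≋-δ scalar (-‿involutive 1#)))
    where
    O : Matrix (suc p) (suc p)
    O = offDiag (suc p)
    scalar : (suc p × y + - 1#) - y ≈ 0#
    scalar = begin
      ((y + p × y) + - 1#) - y ≈⟨ +-congʳ (+-assoc y (p × y) (- 1#)) ⟩
      (y + (p × y + - 1#)) - y ≈⟨ xyx⁻¹≈y y _ ⟩
      p × y + - 1#             ≈⟨ +-congʳ (trans (×≈×1* p y) (trans (*-comm _ y) y·p≈1)) ⟩
      1# + - 1#                ≈⟨ -‿inverseʳ 1# ⟩
      0#                       ∎
      where open SetoidReasoning setoid

¬¬-∀-Fin : ∀ {p} n {P : Fin n → Set p} → (∀ i → ¬ ¬ P i) → ¬ ¬ (∀ i → P i)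
¬¬-∀-Fin zero    _     ¬∀P = ¬∀P (λ ())
¬¬-∀-Fin (suc n) ¬¬P ¬∀P = ¬¬P zero (λ P₀ → ¬¬-∀-Fin n (¬¬P ∘ suc) (¬∀P ∘ ∀-cons P₀))

module TensorRank {c ℓ} (K : Field c ℓ) where

  open Field K hiding (zero)
  open Matrices commRing
  open import Algebra.Properties.Ring ring using (-‿distribˡ-*; -1*x≈-x; -‿involutive; -0#≈0#)
  open import Algebra.Properties.Semiring.Mult semiring using (_×_; ×1-homo-*)
  open import Algebra.Properties.CommutativeSemigroup *-commutativeSemigroup using (interchange)

  δ-factorsThrough-pivot : ∀ {k s} (U : Matrix (suc k) (suc s)) (V : Matrix (suc s) (suc k)) →
    δ ≋ U · V → ∀ i → ¬ U i zero ≈ 0# → FactorsThrough (δ {k}) s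
  δ-factorsThrough-pivot {k} U V δ≋UV i Uᵢ₀≉0 with inverse (U i zero) Uᵢ₀≉0
  ... | w , Uᵢ₀w≈1 = factorsThrough-dropZeroColumn (E · U) (V · F) δ≋EU·VF EU₀≈0
    where
    -- E clears column 0 of U using the pivot row i and then deletes row i; F deletes column i.
    coeff : Fin k → Carrier
    coeff a = - (U (punchIn i a) zero * w)
    E : Matrix k (suc k)
    E a j = δ (punchIn i a) j + coeff a * δ i j
    F : Matrix (suc k) k
    F j b = δ j (punchIn i b)
    EF≋δ : E · F ≋ δ
    EF≋δ a b = begin
      (E · F) a b ≈⟨ sum-δ+δˡ (punchIn i a) i (coeff a) (λ j → F j b) ⟩
      δ (punchIn i a) (punchIn i b) + coeff a * δ i (punchIn i b)
        ≈⟨ +-cong (reflexive (δ-punchIn i a b))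
                  (trans (*-congˡ (reflexive (δ-≢ (punchInᵢ≢i i b ∘ ≡.sym)))) (zeroʳ (coeff a))) ⟩
      δ a b + 0# ≈⟨ +-identityʳ (δ a b) ⟩
      δ a b ∎
      where open SetoidReasoning setoid
    EU₀≈0 : ∀ a → (E · U) a zero ≈ 0#
    EU₀≈0 a = begin
      (E · U) a zero ≈⟨ sum-δ+δˡ (punchIn i a) i (coeff a) (λ j → U j zero) ⟩
      x + - (x * w) * U i zero ≈⟨ +-congˡ (sym (-‿distribˡ-* (x * w) (U i zero))) ⟩
      x + - (x * w * U i zero) ≈⟨ +-congˡ (-‿cong x·w·Uᵢ₀≈x) ⟩
      x + - x                  ≈⟨ -‿inverseʳ x ⟩
      0#                       ∎
      where
      open SetoidReasoning setoid
      x : Carrier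
      x = U (punchIn i a) zero
      x·w·Uᵢ₀≈x : x * w * U i zero ≈ x
      x·w·Uᵢ₀≈x = trans (*-assoc x w _) (trans (*-congˡ (trans (*-comm w _) Uᵢ₀w≈1)) (*-identityʳ x))
    δ≋EU·VF : δ ≋ (E · U) · (V · F)
    δ≋EU·VF = begin
      δ         ≈⟨ EF≋δ ⟨
      E · F     ≈⟨ ·-cong {B = F} (·-identityʳ E) ≋-refl ⟨
      E · δ · F ≈⟨ ·-sandwich E U V F δ≋UV ⟩
      (E · U) · (V · F) ∎
      where open ≋-Reasoning

  -- Equality in K is undecidable, so whether column 0 of U vanishes is only known under ¬¬;
  -- this suffices because the goal is ⊥.
  ¬δ-factorsThrough-< : ∀ {k s} → s ℕ.< k → ¬ FactorsThrough (δ {k}) s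
  ¬δ-factorsThrough-< {suc k} {zero}  _           (U , V , δ≋UV) = 0≉1 (sym (δ≋UV zero zero))
  ¬δ-factorsThrough-< {suc k} {suc s} (ℕ.s≤s s<k) (U , V , δ≋UV) =
    ¬¬-∀-Fin (suc k)
      (λ i Uᵢ₀≉0 → ¬δ-factorsThrough-< s<k (δ-factorsThrough-pivot U V δ≋UV i Uᵢ₀≉0))
      (λ U₀≈0 → ¬δ-factorsThrough-< (m<n⇒m<1+n s<k) (factorsThrough-dropZeroColumn U V δ≋UV U₀≈0))

  δ-factorsThrough⇒≤ : ∀ {k s} → FactorsThrough (δ {k}) s → k ℕ.≤ s
  δ-factorsThrough⇒≤ {k} {s} δ-factors =
    decidable-stable (k ℕ.≤? s) (λ k≰s → ¬δ-factorsThrough-< (≰⇒> k≰s) δ-factors)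

  natK≈×1 : ∀ n → natK K n ≈ n × 1#
  natK≈×1 zero    = refl
  natK≈×1 (suc n) = +-congˡ (natK≈×1 n)

  natK-* : ∀ m n → natK K (m ℕ.* n) ≈ natK K m * natK K n
  natK-* m n = trans (natK≈×1 (m ℕ.* n)) (trans (×1-homo-* m n) (sym (*-cong (natK≈×1 m) (natK≈×1 n))))

  signK : Sign → Carrier
  signK Sign.+ = 1#
  signK Sign.- = - 1#

  signK-* : ∀ s t → signK (s Sign.* t) ≈ signK s * signK t
  signK-* Sign.+ t      = sym (*-identityˡ (signK t))
  signK-* Sign.- Sign.+ = sym (*-identityʳ (- 1#))
  signK-* Sign.- Sign.- = sym (trans (-1*x≈-x (- 1#)) (-‿involutive 1#))

  intK-◃ : ∀ s n → intK K (s ◃ n) ≈ signK s * natK K n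
  intK-◃ s      zero    = sym (zeroʳ (signK s))
  intK-◃ Sign.+ (suc n) = sym (*-identityˡ (natK K (suc n)))
  intK-◃ Sign.- (suc n) = sym (-1*x≈-x (natK K (suc n)))

  intK-sign : ∀ i → intK K i ≈ signK (sign i) * natK K ∣ i ∣
  intK-sign i = ≡.subst (λ j → intK K j ≈ signK (sign i) * natK K ∣ i ∣) (◃-inverse i) (intK-◃ (sign i) ∣ i ∣)

  intK-* : ∀ i j → intK K (i ℤ.* j) ≈ intK K i * intK K j
  intK-* i j = begin
    intK K (sign i Sign.* sign j ◃ ∣ i ∣ ℕ.* ∣ j ∣)
      ≈⟨ intK-◃ (sign i Sign.* sign j) (∣ i ∣ ℕ.* ∣ j ∣) ⟩
    signK (sign i Sign.* sign j) * natK K (∣ i ∣ ℕ.* ∣ j ∣)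
      ≈⟨ *-cong (signK-* (sign i) (sign j)) (natK-* ∣ i ∣ ∣ j ∣) ⟩
    (signK (sign i) * signK (sign j)) * (natK K ∣ i ∣ * natK K ∣ j ∣)
      ≈⟨ interchange (signK (sign i)) (signK (sign j)) (natK K ∣ i ∣) (natK K ∣ j ∣) ⟩
    (signK (sign i) * natK K ∣ i ∣) * (signK (sign j) * natK K ∣ j ∣) ≈⟨ *-cong (intK-sign i) (intK-sign j) ⟨
    intK K i * intK K j                                          ∎
    where open SetoidReasoning setoid

  ⟦_⟧ : ∀ {m n} → (Fin m → Fin n → ℤ) → Matrix m n
  ⟦ A ⟧ i j = intK K (A i j)

  ⟦kronPow⟧ : ∀ {n} (A : Fin n → Fin n → ℤ) t → ⟦ kronPow A t ⟧ ≋ ⟦ A ⟧ ^⊗ t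
  ⟦kronPow⟧ A zero    _ _ = +-identityʳ 1#
  ⟦kronPow⟧ {n} A (suc t) i j = trans (intK-* (A i₁ j₁) (kronPow A t i₂ j₂)) (*-congˡ (⟦kronPow⟧ A t i₂ j₂))
    where
    i₁ j₁ : Fin n
    i₁ = quotient {n} (n ^ t) i
    j₁ = quotient {n} (n ^ t) j
    i₂ j₂ : Fin (n ^ t)
    i₂ = remainder {n} (n ^ t) i
    j₂ = remainder {n} (n ^ t) j

  ⟦offDiagOnes⟧ : ∀ n → ⟦ offDiagOnes n ⟧ ≋ offDiag n
  ⟦offDiagOnes⟧ n i j with i ≟ᶠ j
  ... | yes ≡.refl = sym (trans (+-congˡ (-‿cong (reflexive (δ-refl i)))) (-‿inverseʳ 1#))
  ... | no i≢j     = sym (trans (+-congˡ (-‿cong (reflexive (δ-≢ i≢j)))) (+-congˡ -0#≈0#))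

  sumK≈sum : ∀ n (f : Fin n → Carrier) → sumK K n f ≈ sum f
  sumK≈sum zero    f = refl
  sumK≈sum (suc n) f = +-congˡ (sumK≈sum n (f ∘ suc))

  sumOfSimple⇔factorsThrough : ∀ {m n} {A : Matrix m n} {r} → SumOfSimple K A r ⇔ FactorsThrough A r
  sumOfSimple⇔factorsThrough {r = r} = mk⇔
    (λ (u , v , A≈∑uv) → (λ i k → u k i) , v , λ i j → trans (A≈∑uv i j) (sumK≈sum r _))
    (λ (U , V , A≋UV) → (λ k i → U i k) , V , λ i j → trans (A≋UV i j) (sym (sumK≈sum r _)))

  tensorRank-kronPow : ∀ {m n} {A : Fin n → Fin n → ℤ} →
    IdentityRetract m ⟦ A ⟧ → FactorsThrough ⟦ A ⟧ m → ∀ t {r} → IsTensorRank K (kronPow A t) r → r ≡ m ^ t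
  tensorRank-kronPow {m} {A = A} δ-retract A-factors t {r} (Aᵗ-sum , Aᵗ-minimal) = ≤-antisym
    (Aᵗ-minimal (m ^ t) (Equivalence.from sumOfSimple⇔factorsThrough
      (factorsThrough-≋ (⟦kronPow⟧ A t) (factorsThrough-^⊗ A-factors t))))
    (δ-factorsThrough⇒≤ (identityRetract-^⊗-factorsThrough δ-retract t
      (factorsThrough-≋ (≋-sym (⟦kronPow⟧ A t)) (Equivalence.to sumOfSimple⇔factorsThrough Aᵗ-sum))))

  tensorRank-offDiagOnes-charDiv : ∀ {p} → natK K p ≈ 0# →
    ∀ t {r} → IsTensorRank K (kronPow (offDiagOnes (suc p)) t) r → r ≡ p ^ t
  tensorRank-offDiagOnes-charDiv {p} p≈0 = tensorRank-kronPow
    (identityRetract-≋ (⟦offDiagOnes⟧ (suc p)) (offDiag-identityRetract-charDiv p×1≈0))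
    (factorsThrough-≋ (⟦offDiagOnes⟧ (suc p)) (offDiag-factorsThrough-charDiv p×1≈0))
    where
    p×1≈0 : p × 1# ≈ 0#
    p×1≈0 = trans (sym (natK≈×1 p)) p≈0

  tensorRank-offDiagOnes-charNonDiv : ∀ {p} → ¬ natK K p ≈ 0# →
    ∀ t {r} → IsTensorRank K (kronPow (offDiagOnes (suc p)) t) r → r ≡ suc p ^ t
  tensorRank-offDiagOnes-charNonDiv {p} p≉0 with inverse (natK K p) p≉0
  ... | y , p·y≈1 = tensorRank-kronPow
    (identityRetract-≋ (⟦offDiagOnes⟧ (suc p)) (offDiag-identityRetract-inverse y·p≈1))
    (factorsThrough-self ⟦ offDiagOnes (suc p) ⟧)
    where
    y·p≈1 : y * (p × 1#) ≈ 1#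
    y·p≈1 = trans (*-comm y _) (trans (*-congʳ (sym (natK≈×1 p))) p·y≈1)

open import Data.Nat using (_*_; _≥_)
open import Data.Nat.Properties using (*-comm)
open import Data.Nat.Primality using (Prime; prime⇒nonZero)
open import Data.Nat.Divisibility using (∣-refl; 0∣⇒≡0)

corollary6p4 : ∀ {c₁ ℓ₁ c₂ ℓ₂ : Level} (p : ℕ) → Prime p → (t : ℕ) → t ≥ 1 →
    (K : Field c₁ ℓ₁) → AlgClosed K → HasChar K p →
    (L : Field c₂ ℓ₂) → AlgClosed L → HasChar L 0 →
    (r s : ℕ) →
    IsTensorRank K (kronPow (offDiagOnes (suc p)) t) r →
    IsTensorRank L (kronPow (offDiagOnes (suc p)) t) s →
    r * (suc p) ^ t ≡ s * p ^ t
corollary6p4 p p-prime t _ K _ charK L _ charL r s r-rank s-rank = begin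
  r * suc p ^ t     ≡⟨ ≡.cong (_* suc p ^ t) (TensorRank.tensorRank-offDiagOnes-charDiv K p≈0 t r-rank) ⟩
  p ^ t * suc p ^ t ≡⟨ *-comm (p ^ t) (suc p ^ t) ⟩
  suc p ^ t * p ^ t ≡⟨ ≡.cong (_* p ^ t) (TensorRank.tensorRank-offDiagOnes-charNonDiv L p≉0 t s-rank) ⟨
  s * p ^ t         ∎
  where
  open ≡.≡-Reasoning
  p≈0 : Field._≈_ K (natK K p) (Field.0# K)
  p≈0 = Equivalence.from (charK p) ∣-refl
  p≉0 : ¬ Field._≈_ L (natK L p) (Field.0# L)
  p≉0 = ℕ.≢-nonZero⁻¹ p {{prime⇒nonZero p-prime}} ∘ 0∣⇒≡0 ∘ Equivalence.to (charL p)
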